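{- Let $\mathcal{C}^{\mathbf{pre}}_{\mathbf{dox}}$ be the class of all prestandard doxastic frames and $\mathcal{C}^{\mathbf{sta}}_{\mathbf{dox}}$ the class of all standard doxastic frames. Then $\mathtt{Log}(\mathcal{C}^{\mathbf{pre}}_{\mathbf{dox}})=\mathtt{Log}(\mathcal{C}^{\mathbf{sta}}_{\mathbf{dox}})$. Here: - a frame is doxastic if $sR(\alpha)t$ implies $s\leq t$ for all groups $\alpha$ and all $s,t$; - it is prestandard if $R(\alpha\cup\beta)\subseteq R(\alpha)\cap R(\beta)$ for all groups $\alpha,\beta$; - it is standard if $R(\alpha\cup\beta)=R(\alpha)\cap R(\beta)$ for all groups $\alpha,\beta$.
   Context: **Language.** Let $\mathbf{At}$ be a countably infinite set of atoms and let $\mathbf{Ag}$ be a finite set of agents. A group is a nonempty subset of $\mathbf{Ag}$. Formulas are generated by $$A ::= p \mid (A\rightarrow A) \mid \top \mid \bot \mid (A\vee A) \mid (A\wedge A) \mid [\alpha]A \mid \langle\alpha\rangle A.$$ **Frames.** A frame is a triple $(W,\leq,R)$ where $W$ is a nonempty set, $\leq$ is a preorder on $W$, and $R$ assigns to each group $\alpha$ a binary relation $R(\alpha)$ on $W$. For binary relations $S,T$, write $s\,(S\circ T)\,t$ iff there is $u$ with $sSu$ and $uTt$. Write $\geq$ for the converse of $\leq$. **Models and satisfaction.** A valuation is a map $V:\mathbf{At}\to\wp(W)$ with each $V(p)$ upward closed under $\leq$. Satisfaction in a model $(W,\leq,R,V)$ is defined as follows: - $s\models p$ iff $s\in V(p)$;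 - $s\models A\rightarrow B$ iff for all $t\geq s$, either $t\not\models A$ or $t\models B$; - $s\models\top$, and $s\not\models\bot$; - $\vee$ and $\wedge$ are interpreted pointwise; - $s\models[\alpha]A$ iff for all $t$ with $s\,(\leq\circ R(\alpha))\,t$, $t\models A$; - $s\models\langle\alpha\rangle A$ iff there is $t$ with $s\,(\geq\circ R(\alpha))\,t$ and $t\models A$. A formula is valid in a frame if it is satisfied at every state of every model based on that frame. For a class $\mathcal{C}$ of frames, $\mathtt{Log}(\mathcal{C})$ is the set of formulas valid in every frame in $\mathcal{C}$. -}

module Defs where

open import Level using (Level; 0ℓ)
open import Data.Nat using (ℕ)
open import Data.Product using (Σ; ∃; _×_; _,_)
open import Data.Sum using (_⊎_)
open import Data.Empty using (⊥)
open import Data.Unit using (⊤)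
open import Data.Fin.Subset using (Subset; Nonempty; _∪_)

-- Atoms: ℕ (countably infinite).  Agents: Fin n (finite), n a parameter.
-- A group is a nonempty subset of Fin n.

data Form (n : ℕ) : Set where
  atom : ℕ → Form n
  _⇒_  : Form n → Form n → Form n
  top  : Form n
  bot  : Form n
  _∨_  : Form n → Form n → Form n
  _∧_  : Form n → Form n → Form n
  box  : (α : Subset n) → Nonempty α → Form n → Form n
  dia  : (α : Subset n) → Nonempty α → Form n → Form n

-- A frame (W, ≤, R).  R is given on all subsets; only its values on
-- nonempty subsets (groups) are ever used.
record Frame (n : ℕ) : Set₁ where
  field
    W     : Set
    inhab : W
    _≤_   : W → W → Set
    refl≤ : ∀ s → s ≤ s
    trans≤ : ∀ {s t u} → s ≤ t → t ≤ u → s ≤ u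
    R     : Subset n → W → W → Set

record Model (n : ℕ) : Set₁ where
  field
    frame : Frame n
  open Frame frame public
  field
    V      : ℕ → W → Set
    V-up   : ∀ p {s t} → s ≤ t → V p s → V p t

module _ {n : ℕ} (M : Model n) where
  open Model M

  _⊨_ : W → Form n → Set
  s ⊨ atom p    = V p s
  s ⊨ (A ⇒ B)   = ∀ t → s ≤ t → t ⊨ A → t ⊨ B
  s ⊨ top       = ⊤
  s ⊨ bot       = ⊥
  s ⊨ (A ∨ B)   = (s ⊨ A) ⊎ (s ⊨ B)
  s ⊨ (A ∧ B)   = (s ⊨ A) × (s ⊨ B)
  s ⊨ box α _ A = ∀ u t → s ≤ u → R α u t → t ⊨ A
  s ⊨ dia α _ A = Σ W λ u → Σ W λ t → u ≤ s × R α u t × t ⊨ A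

ValidIn : {n : ℕ} → Frame n → Form n → Set₁
ValidIn {n} F A = (V : ℕ → Frame.W F → Set)
  → (V-up : ∀ p {s t} → Frame._≤_ F s t → V p s → V p t)
  → (s : Frame.W F)
  → _⊨_ (record { frame = F ; V = V ; V-up = V-up }) s A

Doxastic : {n : ℕ} → Frame n → Set
Doxastic {n} F = ∀ (α : Subset n) → Nonempty α → ∀ s t → R α s t → s ≤ t
  where open Frame F

Prestandard : {n : ℕ} → Frame n → Set
Prestandard {n} F = ∀ (α β : Subset n) → Nonempty α → Nonempty β → ∀ s t →
  R (α ∪ β) s t → R α s t × R β s t
  where open Frame F

Standard : {n : ℕ} → Frame n → Set
Standard {n} F = ∀ (α β : Subset n) → Nonempty α → Nonempty β → ∀ s t →
  (R (α ∪ β) s t → R α s t × R β s t) × (R α s t × R β s t → R (α ∪ β) s t)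
  where open Frame F

InLogPreDox : {n : ℕ} → Form n → Set₁
InLogPreDox {n} A = (F : Frame n) → Doxastic F → Prestandard F → ValidIn F A

InLogStaDox : {n : ℕ} → Form n → Set₁
InLogStaDox {n} A = (F : Frame n) → Doxastic F → Standard F → ValidIn F A

-- Tag every world with the group whose relation was used to reach it:
-- α reaches (t , γ) from (u , δ) iff α ⊆ γ and u R(γ) t.  Since
-- α ∪ β ⊆ γ iff α ⊆ γ and β ⊆ γ, the tagged frame is standard, whatever
-- the original frame is.  In a prestandard frame R is antitone in the group,
-- so forgetting the tag preserves truth of every formula and the tagged
-- frame stays doxastic; hence every formula refuted on a prestandard
-- doxastic frame is refuted on a standard doxastic one.
module Submission where

open import Defs
open import Data.Nat using (ℕ)
open import Data.Product using (_×_; _,_; proj₁)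
open import Data.Sum using (inj₁; inj₂; [_,_])
open import Data.Unit using (tt)
open import Data.Fin.Subset using (Subset; Nonempty; _∪_; _⊆_) renaming (⊥ to ∅)
open import Data.Fin.Subset.Properties using (⊆-antisym; p⊆p∪q; q⊆p∪q; x∈p∪q⁻)
open import Function using (id; _∘_)
open import Relation.Binary.PropositionalEquality using (_≡_; subst; sym)

private
  variable
    n : ℕ

∪-least : {p q r : Subset n} → p ⊆ r → q ⊆ r → p ∪ q ⊆ r
∪-least {p = p} {q} p⊆r q⊆r = [ p⊆r , q⊆r ] ∘ x∈p∪q⁻ p q

p⊆q⇒p∪q≡q : (p q : Subset n) → p ⊆ q → p ∪ q ≡ q
p⊆q⇒p∪q≡q p q p⊆q = ⊆-antisym (∪-least p⊆q id) (q⊆p∪q p q)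

Antitone : Frame n → Set
Antitone {n} F = ∀ (α γ : Subset n) → Nonempty α → Nonempty γ → α ⊆ γ →
  ∀ s t → R γ s t → R α s t
  where open Frame F

prestandard⇒antitone : (F : Frame n) → Prestandard F → Antitone F
prestandard⇒antitone F pre α γ neα neγ α⊆γ s t sRγt =
  proj₁ (pre α γ neα neγ s t
    (subst (λ δ → R δ s t) (sym (p⊆q⇒p∪q≡q α γ α⊆γ)) sRγt))
  where open Frame F

standard⇒prestandard : (F : Frame n) → Standard F → Prestandard F
standard⇒prestandard F st α β neα neβ s t = proj₁ (st α β neα neβ s t)

module Tagged (F : Frame n) where
  open Frame F

  -- Tags are arbitrary subsets, but R only ever leads to group tags, which is
  -- what lets prestandardness (stated for groups only) be applied to them.
  tagged : Frame n
  tagged = record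
    { W      = W × Subset n
    ; inhab  = inhab , ∅
    ; _≤_    = λ x y → proj₁ x ≤ proj₁ y
    ; refl≤  = refl≤ ∘ proj₁
    ; trans≤ = trans≤
    ; R      = λ α (s , _) (t , γ) → α ⊆ γ × Nonempty γ × R γ s t
    }

  tagged-standard : Standard tagged
  tagged-standard α β _ _ _ _ =
      (λ (α∪β⊆γ , neγ , sRt) →
         (α∪β⊆γ ∘ p⊆p∪q β , neγ , sRt) , (α∪β⊆γ ∘ q⊆p∪q α β , neγ , sRt))
    , (λ ((α⊆γ , neγ , sRt) , (β⊆γ , _ , _)) → ∪-least α⊆γ β⊆γ , neγ , sRt)

  module _ (anti : Antitone F) where

    tagged-doxastic : Doxastic F → Doxastic tagged
    tagged-doxastic dox α neα (s , _) (t , γ) (α⊆γ , neγ , sRγt) =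
      dox α neα s t (anti α γ neα neγ α⊆γ s t sRγt)

    module _ (V : ℕ → W → Set) (V-up : ∀ p {s t} → s ≤ t → V p s → V p t) where

      M : Model n
      M = record { frame = F ; V = V ; V-up = λ p → V-up p }

      M-tagged : Model n
      M-tagged = record { frame = tagged ; V = λ p → V p ∘ proj₁ ; V-up = λ p → V-up p }

      untag : ∀ A t γ → _⊨_ M-tagged (t , γ) A → _⊨_ M t A
      tag   : ∀ A t γ → _⊨_ M t A → _⊨_ M-tagged (t , γ) A
      untag (atom p)       t γ t⊨p = t⊨p
      untag (A ⇒ B)        t γ t⊨A⇒B t′ t≤t′ t′⊨A =
        untag B t′ γ (t⊨A⇒B (t′ , γ) t≤t′ (tag A t′ γ t′⊨A))
      untag top            t γ _ = tt
      untag bot            t γ ()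
      untag (A ∨ B)        t γ (inj₁ t⊨A) = inj₁ (untag A t γ t⊨A)
      untag (A ∨ B)        t γ (inj₂ t⊨B) = inj₂ (untag B t γ t⊨B)
      untag (A ∧ B)        t γ (t⊨A , t⊨B) = untag A t γ t⊨A , untag B t γ t⊨B
      untag (box α neα A)  t γ t⊨□A u t′ t≤u uRt′ =
        untag A t′ α (t⊨□A (u , γ) (t′ , α) t≤u (id , neα , uRt′))
      untag (dia α neα A)  t γ ((u , _) , (t′ , δ) , u≤t , (α⊆δ , neδ , uRt′) , t′⊨A) =
        u , t′ , u≤t , anti α δ neα neδ α⊆δ u t′ uRt′ , untag A t′ δ t′⊨A
      tag   (atom p)       t γ t⊨p = t⊨p
      tag   (A ⇒ B)        t γ t⊨A⇒B (t′ , δ) t≤t′ t′⊨A =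
        tag B t′ δ (t⊨A⇒B t′ t≤t′ (untag A t′ δ t′⊨A))
      tag   top            t γ _ = tt
      tag   bot            t γ ()
      tag   (A ∨ B)        t γ (inj₁ t⊨A) = inj₁ (tag A t γ t⊨A)
      tag   (A ∨ B)        t γ (inj₂ t⊨B) = inj₂ (tag B t γ t⊨B)
      tag   (A ∧ B)        t γ (t⊨A , t⊨B) = tag A t γ t⊨A , tag B t γ t⊨B
      tag   (box α neα A)  t γ t⊨□A (u , _) (t′ , δ) t≤u (α⊆δ , neδ , uRt′) =
        tag A t′ δ (t⊨□A u t′ t≤u (anti α δ neα neδ α⊆δ u t′ uRt′))
      tag   (dia α neα A)  t γ (u , t′ , u≤t , uRt′ , t′⊨A) =
        (u , γ) , (t′ , α) , u≤t , (id , neα , uRt′) , tag A t′ α t′⊨A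

    valid-tagged⇒valid : (A : Form n) → ValidIn tagged A → ValidIn F A
    valid-tagged⇒valid A valid V V-up s =
      untag V V-up A s ∅ (valid (λ p → V p ∘ proj₁) (λ p → V-up p) (s , ∅))

proposition9 : (n : ℕ) → (A : Form n) →
    (InLogPreDox A → InLogStaDox A) × (InLogStaDox A → InLogPreDox A)
proposition9 n A =
    (λ valid-pre F dox st → valid-pre F dox (standard⇒prestandard F st))
  , (λ valid-sta F dox pre →
       let anti = prestandard⇒antitone F pre
       in  valid-tagged⇒valid F anti A
             (valid-sta (tagged F) (tagged-doxastic F anti dox) (tagged-standard F)))
  where open Tagged
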